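{- Let $k\ge 2$, $m\ge 3$ and $0\le p\le k$ be integers and let $n = 1 + k + (k-p)m + p(m-1)$. Then the number of minimal forts of $T(n,k,m,p)$ is \[ \mathcal{F}_{T(n,k,m,p)} = m^{k-p}(m-1)^p + (k-p)\binom{m}{2} + p\binom{m-1}{2}. \]
   Context: $T(n,k,m,p)$ is the rooted tree of height $2$ with root $r$, where $r$ has $k$ children, and among these $k$ children, $k-p$ have exactly $m$ children each and $p$ have exactly $m-1$ children each (all grandchildren of $r$ are leaves); it has $n = 1+k+(k-p)m+p(m-1)$ vertices. A fort of a graph $G$ is a nonempty set $F\subseteq V(G)$ such that every vertex not in $F$ is adjacent to either zero or at least two vertices of $F$; it is minimal if no proper subset is a fort. $\mathcal{F}_G$ denotes the number of minimal forts of $G$. -}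

module Defs where

open import Data.Nat using (ℕ; zero; suc; _+_; _*_; _∸_; _<_)
open import Data.Fin using (Fin; toℕ)
open import Data.Fin.Subset using (Subset; _∈_; _∉_; _⊂_; Nonempty)
open import Data.Product using (Σ; ∃; _×_; _,_)
open import Data.Sum using (_⊎_)
open import Data.List using (List; length)
open import Data.List.Relation.Unary.Unique.Propositional using (Unique)
import Data.List.Membership.Propositional as LM
open import Relation.Nullary using (¬_)
open import Relation.Binary.PropositionalEquality using (_≡_)

record Graph (n : ℕ) : Set₁ where
  field
    Adj : Fin n → Fin n → Set
open Graph public

-- Fort: nonempty F such that every vertex outside F is adjacent to zero or
-- at least two vertices of F, i.e. it is never adjacent to exactly one:
-- whenever v ∉ F has a neighbour u ∈ F, it has another neighbour w ≠ u in F.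
IsFort : ∀ {n} → Graph n → Subset n → Set
IsFort {n} G F =
  Nonempty F ×
  ((v : Fin n) → v ∉ F → (u : Fin n) → u ∈ F → Adj G v u →
     Σ (Fin n) λ w → w ∈ F × ¬ (w ≡ u) × Adj G v w)

IsMinimalFort : ∀ {n} → Graph n → Subset n → Set
IsMinimalFort G F = IsFort G F × ((F' : _) → F' ⊂ F → ¬ IsFort G F')

-- "The number of minimal forts of G is N": there is a duplicate-free list
-- of subsets whose members are exactly the minimal forts, of length N.
NumMinimalForts : ∀ {n} → Graph n → ℕ → Set
NumMinimalForts {n} G N =
  Σ (List (Subset n)) λ L →
    Unique L ×
    ((F : Subset n) → (LM._∈_ F L → IsMinimalFort G F) × (IsMinimalFort G F → LM._∈_ F L)) ×
    length L ≡ N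

Tsize : ℕ → ℕ → ℕ → ℕ
Tsize k m p = 1 + k + (k ∸ p) * m + p * (m ∸ 1)

-- Edges of T(n,k,m,p), on vertex labels (natural numbers):
--   0 is the root r; 1 .. k are its children;
--   child 1+i (i < k-p) has the m leaves  1+k + i*m + j        (j < m);
--   child 1+(k-p)+i (i < p) has the m-1 leaves
--         1+k + (k-p)*m + i*(m-1) + j                          (j < m-1).
data TEdge (k m p : ℕ) : ℕ → ℕ → Set where
  root-child : ∀ i → i < k → TEdge k m p 0 (1 + i)
  child-leafᴬ : ∀ i j → i < k ∸ p → j < m →
    TEdge k m p (1 + i) (1 + k + i * m + j)
  child-leafᴮ : ∀ i j → i < p → j < m ∸ 1 →
    TEdge k m p (1 + (k ∸ p) + i) (1 + k + (k ∸ p) * m + i * (m ∸ 1) + j)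

T : (k m p : ℕ) → Graph (Tsize k m p)
T k m p = record { Adj = λ u v → TEdge k m p (toℕ u) (toℕ v) ⊎ TEdge k m p (toℕ v) (toℕ u) }

-- Every fort F contains either the root together with one leaf below each child, or two
-- leaves of one child. Indeed, a child in F forces all of its leaves into F, since a leaf's
-- only neighbour is its parent; if the root is in F, every child outside F needs a second
-- neighbour in F, which must be one of its leaves; and if the root is not in F, then F
-- contains a leaf whose parent, when outside F, needs a second neighbour in F, which must
-- be a sibling leaf. Sets of both kinds are forts, and no fort is properly contained in
-- one, so they are exactly the minimal forts: there are m^(k-p) (m-1)^p of the first kind
-- and (k-p) C(m,2) + p C(m-1,2) of the second.

module Submission where

open import Defs
open import Data.Nat using (ℕ; _+_; _*_; _∸_; _^_; _≤_)
open import Data.Nat.Combinatorics using (_C_)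

open import Level using (0ℓ)
open import Data.Bool.Properties using (T-≡)
open import Data.Empty using (⊥-elim)
open import Data.Fin as Fin
  using (Fin; zero; suc; toℕ; fromℕ<; _<_; _↑ˡ_; _↑ʳ_; splitAt; join; combine; remQuot; cast)
open import Data.Fin.Properties
  using (<-cmp; <⇒≢; <-irrefl; <-asym; <-irrelevant; toℕ-injective; toℕ<n; toℕ-fromℕ<; toℕ-cast;
         toℕ-↑ˡ; toℕ-↑ʳ; toℕ-combine; splitAt-↑ˡ; splitAt-↑ʳ; splitAt-join; join-splitAt;
         cast-involutive; remQuot-combine; combine-remQuot)
open import Data.Fin.Subset using (Subset; _∈_; _⊆_)
open import Data.Fin.Subset.Properties using (_∈?_; ⊆-antisym)
open import Data.List using (List; []; _∷_; _++_; [_]; map; length; allFin; cartesianProduct)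
open import Data.List.Properties using (length-map; length-++; length-tabulate)
open import Data.List.Membership.Propositional using () renaming (_∈_ to _∈ˡ_)
open import Data.List.Membership.Propositional.Properties
  using (∈-map⁺; ∈-map⁻; ∈-++⁺ˡ; ∈-++⁺ʳ; ∈-cartesianProduct⁺; ∈-allFin)
open import Data.List.Relation.Binary.Disjoint.Propositional using (Disjoint)
open import Data.List.Relation.Unary.All using ([])
open import Data.List.Relation.Unary.AllPairs using ([]; _∷_)
open import Data.List.Relation.Unary.Any using (here)
open import Data.List.Relation.Unary.Unique.Propositional using (Unique)
open import Data.List.Relation.Unary.Unique.Propositional.Properties
  using (map⁺; ++⁺; cartesianProduct⁺; allFin⁺)
open import Data.Nat.Base using (zero; suc; z≤n; s≤s)
open import Data.Nat.Combinatorics using (nC1≡n; nCk+nC[k+1]≡[n+1]C[k+1])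
open import Data.Nat.Properties
  using (m∸n+n≡m; *-comm; +-assoc; ≤-trans; ≤-reflexive; <-≤-trans; n≤1+n; ∸-monoˡ-≤)
open import Data.Product using (Σ; Σ-syntax; ∃; ∃₂; _×_; _,_; proj₁; proj₂; uncurry)
open import Data.Sum as Sum using (_⊎_; inj₁; inj₂)
open import Data.Sum.Properties using (inj₁-injective; inj₂-injective; ≡-dec)
open import Data.Vec using (Vec; []; _∷_; tabulate; lookup)
open import Data.Vec.Properties
  using (lookup∘tabulate; tabulate∘lookup; tabulate-cong; []=⇒lookup; lookup⇒[]=)
open import Function using (_∘_; id; case_of_)
open import Function.Bundles using (_↔_; Inverse; mk↔ₛ′; _⇔_; mk⇔; Equivalence; Injection)
open import Function.Properties.Inverse using (↔⇒↣)
open import Relation.Binary.Definitions using (DecidableEquality; tri<; tri≈; tri>)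
open import Relation.Binary.PropositionalEquality
  using (_≡_; _≢_; refl; sym; trans; cong; cong₂; subst; subst₂; module ≡-Reasoning)
open import Relation.Nullary using (¬_; yes; no; contradiction)
open import Relation.Nullary.Decidable using (isYes; toWitness; fromWitness)
open import Relation.Unary using (Pred; Decidable; _⊆′_; _≐′_)

-- Forts of a relation

NoLoneNeighbour : {V : Set} → (V → V → Set) → Pred V 0ℓ → Set
NoLoneNeighbour _~_ P = ∀ v → ¬ P v → ∀ u → P u → v ~ u → ∃ λ w → P w × w ≢ u × v ~ w

-- IsFort G F is definitionally IsFortOf (Adj G) (_∈ F).
IsFortOf : {V : Set} → (V → V → Set) → Pred V 0ℓ → Set
IsFortOf _~_ P = ∃ P × NoLoneNeighbour _~_ P

module _ {V : Set} {_~_ : V → V → Set} {P Q : Pred V 0ℓ} where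

  IsFortOf-resp-≐′ : P ≐′ Q → IsFortOf _~_ P → IsFortOf _~_ Q
  IsFortOf-resp-≐′ (P⊆Q , Q⊆P) ((v , Pv) , closed) = (v , P⊆Q v Pv) , closedQ
    where
    closedQ : NoLoneNeighbour _~_ Q
    closedQ v v∉Q u Qu v~u with closed v (v∉Q ∘ P⊆Q v) u (Q⊆P u Qu) v~u
    ... | w , Pw , w≢u , v~w = w , P⊆Q w Pw , w≢u , v~w

module _ {A B : Set} {R : A → A → Set} {S : B → B → Set} (ι : A ↔ B) where
  open Inverse ι

  IsFortOf-↔ : (∀ {x y} → R x y ⇔ S (to x) (to y)) →
               ∀ {P : Pred B 0ℓ} → IsFortOf S P ⇔ IsFortOf R (P ∘ to)
  IsFortOf-↔ R⇔S {P} = mk⇔ pull push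
    where
    R⇒S : ∀ {x y} → R x y → S (to x) (to y)
    R⇒S = Equivalence.to R⇔S

    S⇒R : ∀ {x y} → S (to x) (to y) → R x y
    S⇒R = Equivalence.from R⇔S

    P-from : ∀ {b} → P b → P (to (from b))
    P-from {b} = subst P (sym (strictlyInverseˡ b))

    pull : IsFortOf S P → IsFortOf R (P ∘ to)
    pull ((b , Pb) , closed) = (from b , P-from Pb) , closedR
      where
      closedR : NoLoneNeighbour R (P ∘ to)
      closedR x x∉P y Py xRy with closed (to x) x∉P (to y) Py (R⇒S xRy)
      ... | w , Pw , w≢y , xSw =
        from w , P-from Pw ,
        (λ z≡y → w≢y (trans (sym (strictlyInverseˡ w)) (cong to z≡y))) ,
        S⇒R (subst (S (to x)) (sym (strictlyInverseˡ w)) xSw)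

    push : IsFortOf R (P ∘ to) → IsFortOf S P
    push ((a , Pa) , closed) = (to a , Pa) , closedS
      where
      closedS : NoLoneNeighbour S P
      closedS x x∉P y Py xSy
        with closed (from x) (x∉P ∘ subst P (strictlyInverseˡ x)) (from y) (P-from Py)
                    (S⇒R (subst₂ S (sym (strictlyInverseˡ x)) (sym (strictlyInverseˡ y)) xSy))
      ... | z , Pz , z≢y , xRz =
        to z , Pz ,
        (λ w≡y → z≢y (trans (sym (strictlyInverseʳ z)) (cong from w≡y))) ,
        subst (λ t → S t (to z)) (strictlyInverseˡ x) (R⇒S xRz)

⟦_⟧ : ∀ {n} {P : Pred (Fin n) 0ℓ} → Decidable P → Subset n
⟦ P? ⟧ = tabulate (isYes ∘ P?)

∈⟦⟧⇔ : ∀ {n} {P : Pred (Fin n) 0ℓ} (P? : Decidable P) {x} → x ∈ ⟦ P? ⟧ ⇔ P x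
∈⟦⟧⇔ P? {x} = mk⇔
  (λ x∈ → toWitness (Equivalence.from T-≡ (trans (sym (lookup∘tabulate _ x)) ([]=⇒lookup x∈))))
  (λ Px → lookup⇒[]= x _ (trans (lookup∘tabulate _ x) (Equivalence.to T-≡ (fromWitness Px))))

-- Enumerations of finite types

record Enumeration (A : Set) (N : ℕ) : Set where
  field
    elements : List A
    unique   : Unique elements
    complete : ∀ x → x ∈ˡ elements
    size     : length elements ≡ N

module _ {A B : Set} where

  length-cartesianProduct : ∀ (xs : List A) (ys : List B) →
                            length (cartesianProduct xs ys) ≡ length xs * length ys
  length-cartesianProduct []       ys = refl
  length-cartesianProduct (x ∷ xs) ys = begin
    length (map (x ,_) ys ++ cartesianProduct xs ys)          ≡⟨ length-++ (map (x ,_) ys) ⟩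
    length (map (x ,_) ys) + length (cartesianProduct xs ys)  ≡⟨ cong₂ _+_ (length-map (x ,_) ys)
                                                                          (length-cartesianProduct xs ys) ⟩
    length ys + length xs * length ys                         ∎
    where open ≡-Reasoning

  module _ {M N : ℕ} (eA : Enumeration A M) (eB : Enumeration B N) where
    private
      module EA = Enumeration eA
      module EB = Enumeration eB

    infixr 1 _⊎ᴱ_
    infixr 2 _×ᴱ_

    _⊎ᴱ_ : Enumeration (A ⊎ B) (M + N)
    _⊎ᴱ_ = record
      { elements = map inj₁ EA.elements ++ map inj₂ EB.elements
      ; unique   = ++⁺ (map⁺ inj₁-injective EA.unique) (map⁺ inj₂-injective EB.unique) disjoint
      ; complete = λ { (inj₁ a) → ∈-++⁺ˡ (∈-map⁺ inj₁ (EA.complete a))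
                     ; (inj₂ b) → ∈-++⁺ʳ _ (∈-map⁺ inj₂ (EB.complete b)) }
      ; size     = trans (length-++ (map inj₁ EA.elements))
                         (cong₂ _+_ (trans (length-map inj₁ EA.elements) EA.size)
                                    (trans (length-map inj₂ EB.elements) EB.size))
      }
      where
      disjoint : Disjoint (map inj₁ EA.elements) (map inj₂ EB.elements)
      disjoint (v∈₁ , v∈₂) with ∈-map⁻ inj₁ v∈₁ | ∈-map⁻ inj₂ v∈₂
      ... | _ , _ , refl | _ , _ , ()

    _×ᴱ_ : Enumeration (A × B) (M * N)
    _×ᴱ_ = record
      { elements = cartesianProduct EA.elements EB.elements
      ; unique   = cartesianProduct⁺ EA.unique EB.unique
      ; complete = λ (a , b) → ∈-cartesianProduct⁺ (EA.complete a) (EB.complete b)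
      ; size     = trans (length-cartesianProduct EA.elements EB.elements) (cong₂ _*_ EA.size EB.size)
      }

  map↔ᴱ : ∀ {N} → A ↔ B → Enumeration A N → Enumeration B N
  map↔ᴱ ι e = record
    { elements = map to elements
    ; unique   = map⁺ (Injection.injective (↔⇒↣ ι)) unique
    ; complete = λ b → subst (_∈ˡ map to elements) (strictlyInverseˡ b) (∈-map⁺ to (complete (from b)))
    ; size     = trans (length-map to elements) size
    }
    where
    open Inverse ι
    open Enumeration e

allFinᴱ : ∀ n → Enumeration (Fin n) n
allFinᴱ n = record
  { elements = allFin n ; unique = allFin⁺ n ; complete = ∈-allFin ; size = length-tabulate id }

vecᴱ : ∀ {A N} → Enumeration A N → ∀ l → Enumeration (Vec A l) (N ^ l)
vecᴱ     e zero    = record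
  { elements = [ [] ] ; unique = [] ∷ [] ; complete = λ { [] → here refl } ; size = refl }
vecᴱ {A} e (suc l) = map↔ᴱ ∷↔ (e ×ᴱ vecᴱ e l)
  where
  ∷↔ : (A × Vec A l) ↔ Vec A (suc l)
  ∷↔ = mk↔ₛ′ (uncurry _∷_) (λ { (x ∷ xs) → x , xs }) (λ { (x ∷ xs) → refl }) (λ _ → refl)

lookup-injective : ∀ {A : Set} {l} {u v : Vec A l} → (∀ i → lookup u i ≡ lookup v i) → u ≡ v
lookup-injective {u = u} {v} u≗v = begin
  u                     ≡⟨ tabulate∘lookup u ⟨
  tabulate (lookup u)   ≡⟨ tabulate-cong u≗v ⟩
  tabulate (lookup v)   ≡⟨ tabulate∘lookup v ⟩
  v                     ∎
  where open ≡-Reasoning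

StrictPair : ℕ → Set
StrictPair d = Σ[ i ∈ Fin d ] Σ[ j ∈ Fin d ] i < j

strictPair : ∀ {d} → 2 ≤ d → StrictPair d
strictPair {suc (suc _)} _         = zero , suc zero , s≤s z≤n
strictPair {suc zero}    (s≤s ())

strictPairᴱ : ∀ d → Enumeration (StrictPair d) (d C 2)
strictPairᴱ zero    = record { elements = [] ; unique = [] ; complete = λ { (() , _) } ; size = refl }
strictPairᴱ (suc d) = subst (Enumeration _) pascal (map↔ᴱ extend↔ (allFinᴱ d ⊎ᴱ strictPairᴱ d))
  where
  pascal : d + d C 2 ≡ suc d C 2
  pascal = trans (cong (_+ d C 2) (sym (nC1≡n d))) (nCk+nC[k+1]≡[n+1]C[k+1] d 1)

  extend : Fin d ⊎ StrictPair d → StrictPair (suc d)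
  extend (inj₁ j)             = zero , suc j , s≤s z≤n
  extend (inj₂ (i , j , i<j)) = suc i , suc j , s≤s i<j

  restrict : StrictPair (suc d) → Fin d ⊎ StrictPair d
  restrict (zero  , suc j , _)       = inj₁ j
  restrict (suc i , suc j , s≤s i<j) = inj₂ (i , j , i<j)

  extend↔ : (Fin d ⊎ StrictPair d) ↔ StrictPair (suc d)
  extend↔ = mk↔ₛ′ extend restrict
    (λ { (zero , suc j , s≤s z≤n) → refl ; (suc i , suc j , s≤s i<j) → refl })
    (λ { (inj₁ _) → refl ; (inj₂ _) → refl })

-- Minimal forts

module _ {n} (G : Graph n) where

  isMinimalFort : ∀ {F} → IsFort G F → (∀ F′ → IsFort G F′ → F′ ⊆ F → F ⊆ F′) →
                  IsMinimalFort G F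
  isMinimalFort F-fort ⊆⇒⊇ =
    F-fort , λ { F′ (F′⊆F , x , x∈F , x∉F′) F′-fort → x∉F′ (⊆⇒⊇ F′ F′-fort F′⊆F x∈F) }

  module _ {X : Set} (𝒞 : X → Subset n) (𝒞-minimal : ∀ x → IsMinimalFort G (𝒞 x))
           (fort⊇𝒞 : ∀ {F} → IsFort G F → ∃ λ x → 𝒞 x ⊆ F) where

    minimalFort⇒≡𝒞 : ∀ {F} → IsMinimalFort G F → ∃ λ x → 𝒞 x ≡ F
    minimalFort⇒≡𝒞 {F} (F-fort , F-minimal) with fort⊇𝒞 F-fort
    ... | x , 𝒞x⊆F = x , ⊆-antisym 𝒞x⊆F F⊆𝒞x
      where
      F⊆𝒞x : F ⊆ 𝒞 x
      F⊆𝒞x {y} y∈F with y ∈? 𝒞 x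
      ... | yes y∈𝒞x = y∈𝒞x
      ... | no y∉𝒞x  = ⊥-elim (F-minimal (𝒞 x) (𝒞x⊆F , y , y∈F , y∉𝒞x) (proj₁ (𝒞-minimal x)))

    numMinimalForts : ∀ {N} → Enumeration X N → (∀ {x y} → 𝒞 x ≡ 𝒞 y → x ≡ y) → NumMinimalForts G N
    numMinimalForts e 𝒞-injective =
      map 𝒞 elements , map⁺ 𝒞-injective unique , (λ F → sound , complete′) ,
      trans (length-map 𝒞 elements) size
      where
      open Enumeration e

      sound : ∀ {F} → F ∈ˡ map 𝒞 elements → IsMinimalFort G F
      sound F∈ with ∈-map⁻ 𝒞 F∈
      ... | x , _ , refl = 𝒞-minimal x

      complete′ : ∀ {F} → IsMinimalFort G F → F ∈ˡ map 𝒞 elements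
      complete′ F-minimal with minimalFort⇒≡𝒞 F-minimal
      ... | x , refl = ∈-map⁺ 𝒞 (complete x)

-- Trees of height two

module HeightTwoTree (Ch : Set) (_≟_ : DecidableEquality Ch) (deg : Ch → ℕ) where

  data Vertex : Set where
    root  : Vertex
    child : Ch → Vertex
    leaf  : (c : Ch) → Fin (deg c) → Vertex

  data Edge : Vertex → Vertex → Set where
    root-child : ∀ c → Edge root (child c)
    child-leaf : ∀ c j → Edge (child c) (leaf c j)

  _~_ : Vertex → Vertex → Set
  v ~ w = Edge v w ⊎ Edge w v

  data Transversal (σ : (c : Ch) → Fin (deg c)) : Pred Vertex 0ℓ where
    root∈ : Transversal σ root
    leaf∈ : ∀ c → Transversal σ (leaf c (σ c))

  data LeafPair (c : Ch) (j₁ j₂ : Fin (deg c)) : Pred Vertex 0ℓ where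
    first  : LeafPair c j₁ j₂ (leaf c j₁)
    second : LeafPair c j₁ j₂ (leaf c j₂)

  LeafPairIndex : Set
  LeafPairIndex = Σ Ch (StrictPair ∘ deg)

  ContainsTransversal ContainsLeafPair : Pred Vertex 0ℓ → Set
  ContainsTransversal P = ∃ λ σ → Transversal σ ⊆′ P
  ContainsLeafPair    P = ∃ λ c → ∃₂ λ j₁ j₂ → j₁ < j₂ × LeafPair c j₁ j₂ ⊆′ P

  transversal? : ∀ σ → Decidable (Transversal σ)
  transversal? σ root       = yes root∈
  transversal? σ (child c)  = no λ ()
  transversal? σ (leaf c j) with j Fin.≟ σ c
  ... | yes refl = yes (leaf∈ c)
  ... | no j≢σc  = no λ { (leaf∈ c) → j≢σc refl }

  leafPair? : ∀ c j₁ j₂ → Decidable (LeafPair c j₁ j₂)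
  leafPair? c j₁ j₂ root        = no λ ()
  leafPair? c j₁ j₂ (child _)   = no λ ()
  leafPair? c j₁ j₂ (leaf c′ j) with c′ ≟ c
  ... | no c′≢c = no λ { first → c′≢c refl ; second → c′≢c refl }
  ... | yes refl with j Fin.≟ j₁ | j Fin.≟ j₂
  ...   | yes refl | _        = yes first
  ...   | no _     | yes refl = yes second
  ...   | no j≢j₁  | no j≢j₂  = no λ { first → j≢j₁ refl ; second → j≢j₂ refl }

  leaf∈⇒≡σ : ∀ {σ c j} → Transversal σ (leaf c j) → j ≡ σ c
  leaf∈⇒≡σ (leaf∈ _) = refl

  transversal-cong : ∀ {σ τ} → (∀ c → σ c ≡ τ c) → Transversal σ ⊆′ Transversal τ
  transversal-cong σ≗τ _ root∈     = root∈
  transversal-cong σ≗τ _ (leaf∈ c) = subst (Transversal _ ∘ leaf c) (sym (σ≗τ c)) (leaf∈ c)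

  transversal-⊆⇒≗ : ∀ {σ τ} → Transversal σ ⊆′ Transversal τ → ∀ c → σ c ≡ τ c
  transversal-⊆⇒≗ σ⊆τ c = leaf∈⇒≡σ (σ⊆τ _ (leaf∈ c))

  leafPair-⊆⇒≡ : ∀ {c j₁ j₂ c′ j₁′ j₂′} (j₁<j₂ : j₁ < j₂) (j₁′<j₂′ : j₁′ < j₂′) →
                 LeafPair c j₁ j₂ ⊆′ LeafPair c′ j₁′ j₂′ →
                 _≡_ {A = LeafPairIndex} (c , j₁ , j₂ , j₁<j₂) (c′ , j₁′ , j₂′ , j₁′<j₂′)
  leafPair-⊆⇒≡ j₁<j₂ j₁′<j₂′ pair⊆pair′ with pair⊆pair′ _ first | pair⊆pair′ _ second
  ... | first  | first  = contradiction j₁<j₂ (<-irrefl refl)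
  ... | first  | second = cong (λ lt → _ , _ , _ , lt) (<-irrelevant j₁<j₂ j₁′<j₂′)
  ... | second | first  = contradiction j₁<j₂ (<-asym j₁′<j₂′)
  ... | second | second = contradiction j₁<j₂ (<-irrefl refl)

  transversal-fort : ∀ σ → IsFortOf _~_ (Transversal σ)
  transversal-fort σ = (root , root∈) , closed
    where
    closed : NoLoneNeighbour _~_ (Transversal σ)
    closed _ _ _ root∈     (inj₂ (root-child c))   =
      leaf c (σ c) , leaf∈ c , (λ ()) , inj₁ (child-leaf c (σ c))
    closed _ _ _ (leaf∈ c) (inj₁ (child-leaf _ _)) =
      root , root∈ , (λ ()) , inj₂ (root-child c)
    closed _ _ _ root∈     (inj₁ ())
    closed _ _ _ (leaf∈ c) (inj₂ ())

  leafPair-fort : ∀ {c j₁ j₂} → j₁ ≢ j₂ → IsFortOf _~_ (LeafPair c j₁ j₂)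
  leafPair-fort {c} {j₁} {j₂} j₁≢j₂ = (leaf c j₁ , first) , closed
    where
    closed : NoLoneNeighbour _~_ (LeafPair c j₁ j₂)
    closed _ _ _ first  (inj₁ (child-leaf _ _)) =
      leaf c j₂ , second , (λ { refl → j₁≢j₂ refl }) , inj₁ (child-leaf c j₂)
    closed _ _ _ second (inj₁ (child-leaf _ _)) =
      leaf c j₁ , first , (λ { refl → j₁≢j₂ refl }) , inj₁ (child-leaf c j₁)
    closed _ _ _ first  (inj₂ ())
    closed _ _ _ second (inj₂ ())

  module _ {P : Pred Vertex 0ℓ} (fort : IsFortOf _~_ P) where
    private
      closed : NoLoneNeighbour _~_ P
      closed = proj₂ fort

    child∈⇒leaf∈ : Decidable P → ∀ {c} → P (child c) → ∀ j → P (leaf c j)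
    child∈⇒leaf∈ P? {c} Pc j with P? (leaf c j)
    ... | yes Pl = Pl
    ... | no l∉P with closed (leaf c j) l∉P (child c) Pc (inj₂ (child-leaf c j))
    ...   | _ , _ , w≢c , inj₂ (child-leaf _ _) = contradiction refl w≢c
    ...   | _ , _ , _   , inj₁ ()

    root∈⇒leaf∈ : ∀ {c} → ¬ P (child c) → P root → ∃ λ j → P (leaf c j)
    root∈⇒leaf∈ {c} c∉P Proot with closed (child c) c∉P root Proot (inj₂ (root-child c))
    ... | _ , _  , w≢root , inj₂ (root-child _)   = contradiction refl w≢root
    ... | _ , Pw , _      , inj₁ (child-leaf _ j) = j , Pw

    leaf∈⇒root∈⊎sibling∈ : ∀ {c j} → ¬ P (child c) → P (leaf c j) →
                           P root ⊎ ∃ λ j′ → j′ ≢ j × P (leaf c j′)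
    leaf∈⇒root∈⊎sibling∈ {c} {j} c∉P Pl
      with closed (child c) c∉P (leaf c j) Pl (inj₁ (child-leaf c j))
    ... | _ , Proot , _   , inj₂ (root-child _)    = inj₁ Proot
    ... | _ , Pw    , w≢l , inj₁ (child-leaf _ j′) = inj₂ (j′ , (λ { refl → w≢l refl }) , Pw)

  twoLeaves∈⇒containsLeafPair : ∀ {P : Pred Vertex 0ℓ} {c j j′} →
                                j ≢ j′ → P (leaf c j) → P (leaf c j′) → ContainsLeafPair P
  twoLeaves∈⇒containsLeafPair {c = c} {j} {j′} j≢j′ Pj Pj′ with <-cmp j j′
  ... | tri< j<j′ _ _ = c , j , j′ , j<j′ , λ { _ first → Pj ; _ second → Pj′ }
  ... | tri≈ _ j≡j′ _ = contradiction j≡j′ j≢j′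
  ... | tri> _ _ j′<j = c , j′ , j , j′<j , λ { _ first → Pj′ ; _ second → Pj }

  module _ (2≤deg : ∀ c → 2 ≤ deg c) {P : Pred Vertex 0ℓ} (P? : Decidable P)
           (fort : IsFortOf _~_ P) where

    private
      child∈⇒containsLeafPair : ∀ {c} → P (child c) → ContainsLeafPair P
      child∈⇒containsLeafPair {c} Pc with strictPair (2≤deg c)
      ... | j₁ , j₂ , j₁<j₂ =
        c , j₁ , j₂ , j₁<j₂ ,
        λ { _ first → child∈⇒leaf∈ fort P? Pc j₁ ; _ second → child∈⇒leaf∈ fort P? Pc j₂ }

      root∈⇒leaf∈′ : P root → ∀ c → ∃ λ j → P (leaf c j)
      root∈⇒leaf∈′ Proot c with P? (child c)
      ... | yes Pc  = let j = proj₁ (strictPair (2≤deg c)) in j , child∈⇒leaf∈ fort P? Pc j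
      ... | no c∉P  = root∈⇒leaf∈ fort c∉P Proot

    fort⊇transversal⊎leafPair : ContainsTransversal P ⊎ ContainsLeafPair P
    fort⊇transversal⊎leafPair with P? root
    ... | yes Proot =
      inj₁ (proj₁ ∘ root∈⇒leaf∈′ Proot ,
            λ { _ root∈ → Proot ; _ (leaf∈ c) → proj₂ (root∈⇒leaf∈′ Proot c) })
    ... | no root∉P with proj₁ fort
    ...   | root , Proot = contradiction Proot root∉P
    ...   | child c , Pc = inj₂ (child∈⇒containsLeafPair Pc)
    ...   | leaf c j , Pl with P? (child c)
    ...     | yes Pc = inj₂ (child∈⇒containsLeafPair Pc)
    ...     | no c∉P with leaf∈⇒root∈⊎sibling∈ fort c∉P Pl
    ...       | inj₁ Proot               = contradiction Proot root∉P
    ...       | inj₂ (j′ , j′≢j , Pl′)   = inj₂ (twoLeaves∈⇒containsLeafPair j′≢j Pl′ Pl)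

  module _ {Q : Pred Vertex 0ℓ} (fort : IsFortOf _~_ Q) where

    leafPair-⊆-fort : ∀ {c j₁ j₂} → Q ⊆′ LeafPair c j₁ j₂ → LeafPair c j₁ j₂ ⊆′ Q
    leafPair-⊆-fort {c} {j₁} {j₂} Q⊆pair = λ { _ first → proj₁ Qpair ; _ second → proj₂ Qpair }
      where
      sibling : ∀ {j} → Q (leaf c j) → ∃ λ j′ → j′ ≢ j × Q (leaf c j′)
      sibling Qj with leaf∈⇒root∈⊎sibling∈ fort (λ Qc → case Q⊆pair _ Qc of λ ()) Qj
      ... | inj₁ Qroot = case Q⊆pair _ Qroot of λ ()
      ... | inj₂ Qj′   = Qj′

      both : ∀ {v} → Q v → Q (leaf c j₁) × Q (leaf c j₂)
      both {v} Qv with Q⊆pair v Qv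
      ... | first with sibling Qv
      ...   | j′ , j′≢ , Qj′ with Q⊆pair _ Qj′
      ...     | first  = contradiction refl j′≢
      ...     | second = Qv , Qj′
      both {v} Qv | second with sibling Qv
      ...   | j′ , j′≢ , Qj′ with Q⊆pair _ Qj′
      ...     | first  = Qj′ , Qv
      ...     | second = contradiction refl j′≢

      Qpair : Q (leaf c j₁) × Q (leaf c j₂)
      Qpair = both (proj₂ (proj₁ fort))

    transversal-⊆-fort : ∀ {σ} → Q ⊆′ Transversal σ → Transversal σ ⊆′ Q
    transversal-⊆-fort {σ} Q⊆T = λ { _ root∈ → Qroot ; _ (leaf∈ c) → Qleaf c }
      where
      child∉Q : ∀ {c} → ¬ Q (child c)
      child∉Q Qc with Q⊆T _ Qc
      ... | ()

      Qroot : Q root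
      Qroot with proj₁ fort
      ... | v , Qv with Q⊆T v Qv
      ...   | root∈   = Qv
      ...   | leaf∈ c with leaf∈⇒root∈⊎sibling∈ fort child∉Q Qv
      ...     | inj₁ Qr                 = Qr
      ...     | inj₂ (j′ , j′≢σc , Qj′) = contradiction (leaf∈⇒≡σ (Q⊆T _ Qj′)) j′≢σc

      Qleaf : ∀ c → Q (leaf c (σ c))
      Qleaf c with root∈⇒leaf∈ fort child∉Q Qroot
      ... | j , Qj = subst (Q ∘ leaf c) (leaf∈⇒≡σ (Q⊆T _ Qj)) Qj

  module Labelled {n} (G : Graph n) (ι : Vertex ↔ Fin n)
                  (~⇔Adj : ∀ {v w} → v ~ w ⇔ Adj G (Inverse.to ι v) (Inverse.to ι w)) where
    open Inverse ι

    isFort⇔ : ∀ {F} → IsFort G F ⇔ IsFortOf _~_ (λ v → to v ∈ F)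
    isFort⇔ = IsFortOf-↔ ι ~⇔Adj

    ⌊_⌋ : {S : Pred Vertex 0ℓ} → Decidable S → Subset n
    ⌊ S? ⌋ = ⟦ S? ∘ from ⟧

    module _ {S : Pred Vertex 0ℓ} (S? : Decidable S) where

      to∈⌊⌋⇔ : ∀ {v} → to v ∈ ⌊ S? ⌋ ⇔ S v
      to∈⌊⌋⇔ {v} = mk⇔ (subst S (strictlyInverseʳ v) ∘ Equivalence.to (∈⟦⟧⇔ (S? ∘ from)))
                        (Equivalence.from (∈⟦⟧⇔ (S? ∘ from)) ∘ subst S (sym (strictlyInverseʳ v)))

      ⌊⌋⊆ : ∀ {F} → S ⊆′ (λ v → to v ∈ F) → ⌊ S? ⌋ ⊆ F
      ⌊⌋⊆ {F} S⊆F {x} x∈ =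
        subst (_∈ F) (strictlyInverseˡ x) (S⊆F (from x) (Equivalence.to (∈⟦⟧⇔ (S? ∘ from)) x∈))

      ⊆⌊⌋ : ∀ {F} → F ⊆ ⌊ S? ⌋ → (λ v → to v ∈ F) ⊆′ S
      ⊆⌊⌋ F⊆S v v∈F = Equivalence.to to∈⌊⌋⇔ (F⊆S v∈F)

      ⌊⌋-minimal : IsFortOf _~_ S → (∀ {Q} → IsFortOf _~_ Q → Q ⊆′ S → S ⊆′ Q) →
                   IsMinimalFort G ⌊ S? ⌋
      ⌊⌋-minimal S-fort S-minimal = isMinimalFort G ⌊S⌋-fort λ F F-fort F⊆S →
        ⌊⌋⊆ (S-minimal (Equivalence.to isFort⇔ F-fort) (⊆⌊⌋ F⊆S))
        where
        ⌊S⌋-fort : IsFort G ⌊ S? ⌋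
        ⌊S⌋-fort = Equivalence.from isFort⇔ (IsFortOf-resp-≐′
          ((λ _ → Equivalence.from to∈⌊⌋⇔) , (λ _ → Equivalence.to to∈⌊⌋⇔)) S-fort)

    ⌊⌋≡⇒⊆′ : ∀ {S S′ : Pred Vertex 0ℓ} (S? : Decidable S) (S′? : Decidable S′) →
             ⌊ S? ⌋ ≡ ⌊ S′? ⌋ → S ⊆′ S′
    ⌊⌋≡⇒⊆′ S? S′? eq v Sv =
      Equivalence.to (to∈⌊⌋⇔ S′?) (subst (to v ∈_) eq (Equivalence.from (to∈⌊⌋⇔ S?) Sv))

-- The tree T(n,k,m,p)

module TreeT (k m p : ℕ) (p≤k : p ≤ k) where

  Child : Set
  Child = Fin (k ∸ p) ⊎ Fin p

  degree : Child → ℕ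
  degree (inj₁ _) = m
  degree (inj₂ _) = m ∸ 1

  open HeightTwoTree Child (≡-dec Fin._≟_ Fin._≟_) degree public

  private
    a m′ : ℕ
    a  = k ∸ p
    m′ = m ∸ 1

    a+p≡k : a + p ≡ k
    a+p≡k = m∸n+n≡m p≤k

  encode : Vertex → Fin (Tsize k m p)
  encode root              = zero
  encode (child c)         = suc (cast a+p≡k (join a p c)) ↑ˡ a * m ↑ˡ p * m′
  encode (leaf (inj₁ i) j) = (suc k ↑ʳ combine i j) ↑ˡ p * m′
  encode (leaf (inj₂ i) j) = suc k + a * m ↑ʳ combine i j

  private
    leafᴬ : Fin a × Fin m → Vertex
    leafᴬ (i , j) = leaf (inj₁ i) j

    leafᴮ : Fin p × Fin m′ → Vertex
    leafᴮ (i , j) = leaf (inj₂ i) j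

    decodeUpper : Fin (suc k) → Vertex
    decodeUpper zero    = root
    decodeUpper (suc c) = child (splitAt a (cast (sym a+p≡k) c))

    decodeInner : Fin (suc k) ⊎ Fin (a * m) → Vertex
    decodeInner (inj₁ x) = decodeUpper x
    decodeInner (inj₂ y) = leafᴬ (remQuot m y)

    decodeOuter : Fin (suc k + a * m) ⊎ Fin (p * m′) → Vertex
    decodeOuter (inj₁ x) = decodeInner (splitAt (suc k) x)
    decodeOuter (inj₂ y) = leafᴮ (remQuot m′ y)

  decode : Fin (Tsize k m p) → Vertex
  decode = decodeOuter ∘ splitAt (suc k + a * m)

  decode-encode : ∀ v → decode (encode v) ≡ v
  decode-encode root = refl
  decode-encode (child c) =
    trans (cong decodeOuter (splitAt-↑ˡ (suc k + a * m) (ĉ ↑ˡ a * m) (p * m′)))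
    (trans (cong decodeInner (splitAt-↑ˡ (suc k) ĉ (a * m)))
    (cong child (trans (cong (splitAt a) (cast-involutive (sym a+p≡k) a+p≡k (join a p c)))
                       (splitAt-join a p c))))
    where
    ĉ : Fin (suc k)
    ĉ = suc (cast a+p≡k (join a p c))
  decode-encode (leaf (inj₁ i) j) =
    trans (cong decodeOuter (splitAt-↑ˡ (suc k + a * m) (suc k ↑ʳ combine i j) (p * m′)))
    (trans (cong decodeInner (splitAt-↑ʳ (suc k) (a * m) (combine i j)))
    (cong leafᴬ (remQuot-combine i j)))
  decode-encode (leaf (inj₂ i) j) =
    trans (cong decodeOuter (splitAt-↑ʳ (suc k + a * m) (p * m′) (combine i j)))
    (cong leafᴮ (remQuot-combine i j))

  encode-decode : ∀ x → encode (decode x) ≡ x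
  encode-decode x =
    trans (outer (splitAt (suc k + a * m) x)) (join-splitAt (suc k + a * m) (p * m′) x)
    where
    inner : ∀ s → encode (decodeInner s) ≡ join (suc k) (a * m) s ↑ˡ p * m′
    inner (inj₁ zero)    = refl
    inner (inj₁ (suc c)) = cong (λ c′ → suc c′ ↑ˡ a * m ↑ˡ p * m′)
      (trans (cong (cast a+p≡k) (join-splitAt a p _)) (cast-involutive a+p≡k (sym a+p≡k) c))
    inner (inj₂ y)       = cong (λ y′ → (suc k ↑ʳ y′) ↑ˡ p * m′) (combine-remQuot {a} m y)

    outer : ∀ s → encode (decodeOuter s) ≡ join (suc k + a * m) (p * m′) s
    outer (inj₁ x) =
      trans (inner (splitAt (suc k) x)) (cong (_↑ˡ p * m′) (join-splitAt (suc k) (a * m) x))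
    outer (inj₂ y) = cong (suc k + a * m ↑ʳ_) (combine-remQuot {p} m′ y)

  ι : Vertex ↔ Fin (Tsize k m p)
  ι = mk↔ₛ′ encode decode encode-decode decode-encode

  label : Vertex → ℕ
  label = toℕ ∘ encode

  label-injective : ∀ {v w} → label v ≡ label w → v ≡ w
  label-injective {v} {w} eq = begin
    v                 ≡⟨ decode-encode v ⟨
    decode (encode v) ≡⟨ cong decode (toℕ-injective eq) ⟩
    decode (encode w) ≡⟨ decode-encode w ⟩
    w                 ∎
    where open ≡-Reasoning

  private
    toℕ-↑ʳ-combine : ∀ {r d} s (i : Fin r) (j : Fin d) → toℕ (s ↑ʳ combine i j) ≡ s + toℕ i * d + toℕ j
    toℕ-↑ʳ-combine {d = d} s i j = begin
      toℕ (s ↑ʳ combine i j)   ≡⟨ toℕ-↑ʳ s (combine i j) ⟩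
      s + toℕ (combine i j)    ≡⟨ cong (s +_) (toℕ-combine i j) ⟩
      s + (d * toℕ i + toℕ j)  ≡⟨ cong (λ t → s + (t + toℕ j)) (*-comm d (toℕ i)) ⟩
      s + (toℕ i * d + toℕ j)  ≡⟨ +-assoc s (toℕ i * d) (toℕ j) ⟨
      s + toℕ i * d + toℕ j    ∎
      where open ≡-Reasoning

  label-child : ∀ c → label (child c) ≡ suc (toℕ (join a p c))
  label-child c =
    cong suc (trans (toℕ-↑ˡ _ (p * m′)) (trans (toℕ-↑ˡ _ (a * m)) (toℕ-cast a+p≡k (join a p c))))

  label-childᴬ : ∀ i → label (child (inj₁ i)) ≡ suc (toℕ i)
  label-childᴬ i = trans (label-child (inj₁ i)) (cong suc (toℕ-↑ˡ i p))

  label-childᴮ : ∀ i → label (child (inj₂ i)) ≡ suc (a + toℕ i)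
  label-childᴮ i = trans (label-child (inj₂ i)) (cong suc (toℕ-↑ʳ a i))

  label-leafᴬ : ∀ i j → label (leaf (inj₁ i) j) ≡ suc k + toℕ i * m + toℕ j
  label-leafᴬ i j = trans (toℕ-↑ˡ (suc k ↑ʳ combine i j) (p * m′)) (toℕ-↑ʳ-combine (suc k) i j)

  label-leafᴮ : ∀ i j → label (leaf (inj₂ i) j) ≡ suc k + a * m + toℕ i * m′ + toℕ j
  label-leafᴮ i j = toℕ-↑ʳ-combine (suc k + a * m) i j

  edge⇒TEdge : ∀ {v w} → Edge v w → TEdge k m p (label v) (label w)
  edge⇒TEdge (root-child c) =
    subst (TEdge k m p 0) (sym (label-child c))
      (root-child _ (<-≤-trans (toℕ<n (join a p c)) (≤-reflexive a+p≡k)))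
  edge⇒TEdge (child-leaf (inj₁ i) j) =
    subst₂ (TEdge k m p) (sym (label-childᴬ i)) (sym (label-leafᴬ i j))
      (child-leafᴬ _ _ (toℕ<n i) (toℕ<n j))
  edge⇒TEdge (child-leaf (inj₂ i) j) =
    subst₂ (TEdge k m p) (sym (label-childᴮ i)) (sym (label-leafᴮ i j))
      (child-leafᴮ _ _ (toℕ<n i) (toℕ<n j))

  TEdge-labelled : ∀ {x y} → TEdge k m p x y → ∃₂ λ v w → Edge v w × label v ≡ x × label w ≡ y
  TEdge-labelled (root-child i i<k) =
    root , child c , root-child c , refl ,
    trans (label-child c) (cong suc
      (trans (cong toℕ (join-splitAt a p _)) (trans (toℕ-cast (sym a+p≡k) _) (toℕ-fromℕ< i<k))))
    where
    c : Child
    c = splitAt a (cast (sym a+p≡k) (fromℕ< i<k))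
  TEdge-labelled (child-leafᴬ i j i<a j<m) =
    child (inj₁ (fromℕ< i<a)) , leaf (inj₁ (fromℕ< i<a)) (fromℕ< j<m) , child-leaf _ _ ,
    trans (label-childᴬ _) (cong suc (toℕ-fromℕ< i<a)) ,
    trans (label-leafᴬ _ _)
      (cong₂ (λ s t → suc k + s * m + t) (toℕ-fromℕ< i<a) (toℕ-fromℕ< j<m))
  TEdge-labelled (child-leafᴮ i j i<p j<m′) =
    child (inj₂ (fromℕ< i<p)) , leaf (inj₂ (fromℕ< i<p)) (fromℕ< j<m′) , child-leaf _ _ ,
    trans (label-childᴮ _) (cong (λ s → suc (a + s)) (toℕ-fromℕ< i<p)) ,
    trans (label-leafᴮ _ _)
      (cong₂ (λ s t → suc k + a * m + s * m′ + t) (toℕ-fromℕ< i<p) (toℕ-fromℕ< j<m′))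

  TEdge⇒edge : ∀ {v w} → TEdge k m p (label v) (label w) → Edge v w
  TEdge⇒edge e with TEdge-labelled e
  ... | v′ , w′ , e′ , v′≡v , w′≡w = subst₂ Edge (label-injective v′≡v) (label-injective w′≡w) e′

  ~⇔Adj : ∀ {v w} → v ~ w ⇔ Adj (T k m p) (encode v) (encode w)
  ~⇔Adj = mk⇔ (Sum.map edge⇒TEdge edge⇒TEdge) (Sum.map TEdge⇒edge TEdge⇒edge)

module MinimalFortsOfT (k m p : ℕ) (p≤k : p ≤ k) (3≤m : 3 ≤ m) where
  open TreeT k m p p≤k
  open Labelled (T k m p) ι ~⇔Adj

  -- Vectors rather than functions, so that equal transversals have equal indices.
  Choice : Set
  Choice = Vec (Fin m) (k ∸ p) × Vec (Fin (m ∸ 1)) p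

  choice : Choice → (c : Child) → Fin (degree c)
  choice (σ₁ , σ₂) (inj₁ i) = lookup σ₁ i
  choice (σ₁ , σ₂) (inj₂ i) = lookup σ₂ i

  choice-injective : ∀ {σs τs} → (∀ c → choice σs c ≡ choice τs c) → σs ≡ τs
  choice-injective σs≗τs =
    cong₂ _,_ (lookup-injective (σs≗τs ∘ inj₁)) (lookup-injective (σs≗τs ∘ inj₂))

  Index : Set
  Index = Choice ⊎ LeafPairIndex

  candidate : Index → Subset (Tsize k m p)
  candidate (inj₁ σs)                = ⌊ transversal? (choice σs) ⌋
  candidate (inj₂ (c , j₁ , j₂ , _)) = ⌊ leafPair? c j₁ j₂ ⌋

  candidate-minimal : ∀ x → IsMinimalFort (T k m p) (candidate x)
  candidate-minimal (inj₁ σs) =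
    ⌊⌋-minimal (transversal? (choice σs)) (transversal-fort (choice σs))
      (λ fort → transversal-⊆-fort fort)
  candidate-minimal (inj₂ (c , j₁ , j₂ , j₁<j₂)) =
    ⌊⌋-minimal (leafPair? c j₁ j₂) (leafPair-fort (<⇒≢ j₁<j₂))
      (λ fort → leafPair-⊆-fort fort)

  2≤degree : ∀ c → 2 ≤ degree c
  2≤degree (inj₁ _) = ≤-trans (n≤1+n 2) 3≤m
  2≤degree (inj₂ _) = ∸-monoˡ-≤ 1 3≤m

  fort⊇candidate : ∀ {F} → IsFort (T k m p) F → ∃ λ x → candidate x ⊆ F
  fort⊇candidate {F} F-fort
    with fort⊇transversal⊎leafPair 2≤degree (λ v → encode v ∈? F) (Equivalence.to isFort⇔ F-fort)
  ... | inj₁ (σ , σ⊆F) =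
    inj₁ σs , ⌊⌋⊆ (transversal? (choice σs)) (λ v → σ⊆F v ∘ transversal-cong choice-tabulate v)
    where
    σs : Choice
    σs = tabulate (σ ∘ inj₁) , tabulate (σ ∘ inj₂)

    choice-tabulate : ∀ c → choice σs c ≡ σ c
    choice-tabulate (inj₁ i) = lookup∘tabulate (σ ∘ inj₁) i
    choice-tabulate (inj₂ i) = lookup∘tabulate (σ ∘ inj₂) i
  ... | inj₂ (c , j₁ , j₂ , j₁<j₂ , pair⊆F) =
    inj₂ (c , j₁ , j₂ , j₁<j₂) , ⌊⌋⊆ (leafPair? c j₁ j₂) pair⊆F

  candidate-injective : ∀ {x y} → candidate x ≡ candidate y → x ≡ y
  candidate-injective {inj₁ _} {inj₁ _} eq =
    cong inj₁ (choice-injective (transversal-⊆⇒≗ (⌊⌋≡⇒⊆′ (transversal? _) (transversal? _) eq)))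
  candidate-injective {inj₁ _} {inj₂ _} eq with ⌊⌋≡⇒⊆′ (transversal? _) (leafPair? _ _ _) eq _ root∈
  ... | ()
  candidate-injective {inj₂ _} {inj₁ _} eq with ⌊⌋≡⇒⊆′ (transversal? _) (leafPair? _ _ _) (sym eq) _ root∈
  ... | ()
  candidate-injective {inj₂ (_ , _ , _ , j₁<j₂)} {inj₂ (_ , _ , _ , j₁′<j₂′)} eq =
    cong inj₂ (leafPair-⊆⇒≡ j₁<j₂ j₁′<j₂′ (⌊⌋≡⇒⊆′ (leafPair? _ _ _) (leafPair? _ _ _) eq))

  indexᴱ : Enumeration Index (m ^ (k ∸ p) * (m ∸ 1) ^ p + (k ∸ p) * (m C 2) + p * ((m ∸ 1) C 2))
  indexᴱ = subst (Enumeration Index) (sym (+-assoc (m ^ (k ∸ p) * (m ∸ 1) ^ p) _ _))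
    ((vecᴱ (allFinᴱ m) (k ∸ p) ×ᴱ vecᴱ (allFinᴱ (m ∸ 1)) p) ⊎ᴱ
     map↔ᴱ Σ-⊎↔ ((allFinᴱ (k ∸ p) ×ᴱ strictPairᴱ m) ⊎ᴱ (allFinᴱ p ×ᴱ strictPairᴱ (m ∸ 1))))
    where
    Σ-⊎↔ : ((Fin (k ∸ p) × StrictPair m) ⊎ (Fin p × StrictPair (m ∸ 1))) ↔ LeafPairIndex
    Σ-⊎↔ = mk↔ₛ′ (λ { (inj₁ (i , q)) → inj₁ i , q ; (inj₂ (i , q)) → inj₂ i , q })
                 (λ { (inj₁ i , q) → inj₁ (i , q) ; (inj₂ i , q) → inj₂ (i , q) })
                 (λ { (inj₁ _ , _) → refl ; (inj₂ _ , _) → refl })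
                 (λ { (inj₁ _) → refl ; (inj₂ _) → refl })

-- The count also holds for k < 2.
proposition6 : (k m p : ℕ) → 2 ≤ k → 3 ≤ m → p ≤ k →
    NumMinimalForts (T k m p)
      (m ^ (k ∸ p) * (m ∸ 1) ^ p + (k ∸ p) * (m C 2) + p * ((m ∸ 1) C 2))
proposition6 k m p _ 3≤m p≤k =
  numMinimalForts (T k m p) candidate candidate-minimal fort⊇candidate indexᴱ candidate-injective
  where open MinimalFortsOfT k m p p≤k 3≤m
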